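{- For every item sequence $I$, the algorithm $MM$ satisfies $MM(I) \leq \frac{3}{2}\cdot OPT(I) + 1$.
   Context: Classic bin packing: an input is an item sequence $I=(a_1,\dots,a_n)\in(0,1]^n$ (item $i$ has size $a_i$). A solution (assignment) is a map $f:\{1,\dots,n\}\to\mathbb{N}$ such that for every bin $j$, $\sum_{i:f(i)=j} a_i \le 1$; its cost is the number of non-empty bins $|f(\{1,\dots,n\})|$. $OPT(I)$ is the minimum cost over all assignments, and $ALG(I)$ denotes the cost of the assignment output by algorithm $ALG$. Algorithm $MM$: sort $I$ in non-increasing order of size, obtaining $(a_1,\dots,a_n)$, and keep a head pointer $h=1$, a tail pointer $t=n$, and a single current open bin (initially empty). While items remain ($h\le t$): if the head item $a_h$ fits into the current bin (current load plus $a_h\le 1$), pack it there and advance $h$; otherwise, if the tail item $a_t$ fits, pack it there and decrease $t$; otherwise close the current bin (it never receives items again) and open a new empty bin as the current bin.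
   Formalization: The item sizes $a_i$ are rational numbers in (0,1]. -}

module Defs where

open import Data.Bool using (Bool; true; false; if_then_else_)
open import Data.Nat as ℕ using (ℕ; zero; suc)
open import Data.Fin using (Fin)
open import Data.List as List using (List; allFin; deduplicate)
open import Data.Vec as Vec using (Vec; []; _∷_; lookup; toList; fromList)
open import Data.Rational using (ℚ; 0ℚ; 1ℚ; _+_; _<_; _≤_)
open import Data.Rational.Properties using (_≤?_; ≤-decTotalOrder)
open import Data.Product using (_×_)
open import Relation.Nullary.Decidable using (⌊_⌋; yes; no)
import Data.List.Sort as Sort

ValidItems : ∀ {n} → Vec ℚ n → Set
ValidItems {n} I = (i : Fin n) → (0ℚ < lookup I i) × (lookup I i ≤ 1ℚ)

Assignment : ℕ → Set
Assignment n = Fin n → ℕ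

load : ∀ {n} → Vec ℚ n → Assignment n → ℕ → ℚ
load {n} I f j =
  List.foldr _+_ 0ℚ
    (List.map (λ i → if ⌊ f i ℕ.≟ j ⌋ then lookup I i else 0ℚ) (allFin n))

Feasible : ∀ {n} → Vec ℚ n → Assignment n → Set
Feasible I f = ∀ j → load I f j ≤ 1ℚ

cost : ∀ {n} → Assignment n → ℕ
cost {n} f = List.length (deduplicate ℕ._≟_ (List.map f (allFin n)))

sortDesc : List ℚ → List ℚ
sortDesc xs = List.reverse (Sort.sort ≤-decTotalOrder xs)

-- The MM loop on k remaining items (a deque: head = first, tail = last),
-- with current bin load `ld`, flag `used` = current bin non-empty.
-- Returns the number of non-empty bins used from now on (incl. current).
-- In the "neither fits" case the current bin is closed, a new empty bin is
-- opened, and (since the head item has size ≤ 1) the head item is packed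
-- into it immediately — exactly the next iteration of MM.
mmLoop : (k : ℕ) → ℚ → Bool → Vec ℚ k → ℕ
mmLoop zero ld used [] = if used then 1 else 0
mmLoop (suc k) ld used (x ∷ xs) with (ld + x) ≤? 1ℚ
... | yes _ = mmLoop k (ld + x) true xs
... | no _ with (ld + Vec.last (x ∷ xs)) ≤? 1ℚ
...   | yes _ = mmLoop k (ld + Vec.last (x ∷ xs)) true (Vec.init (x ∷ xs))
...   | no _ = (if used then 1 else 0) ℕ.+ mmLoop k x true xs

MM : ∀ {n} → Vec ℚ n → ℕ
MM I = mmLoop _ 0ℚ false (fromList (sortDesc (toList I)))

{-# OPTIONS --safe #-}
module Submission where

-- Any packing with c bins has total size at most c and total weight at most 3c, where an
-- item weighs 2 if it is larger than ½, 1 if it lies in (⅓, ½] and 0 otherwise: a bin holds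
-- at most one item larger than ½ and at most two larger than ⅓.
--
-- MM closes a bin only when neither the largest nor the smallest remaining item fits. If it
-- closes a bin of load at most ⅔, the smallest remaining item, hence every remaining item,
-- is larger than ⅓; from then on each bin receives an item larger than ½ or two items larger
-- than ⅓, so it has weight at least 2. A bin opened by an item of size at most ½ leaves only
-- items of size at most ½; each such bin receives a second item, after which every remaining
-- item is at most half its load, so it is closed only with load above ⅔. Hence either every
-- bin but the last has load above ⅔, and 2(MM − 1) < 3·size, or every bin but the last has
-- weight at least 2 (bins before the switch hold an item larger than ½), and
-- 2(MM − 1) ≤ weight.

open import Defs
open import Data.Nat using (ℕ; _≤_; _*_; _+_)
open import Data.Vec using (Vec)
open import Data.Rational using (ℚ)

open import Algebra.Bundles using (CommutativeMonoid)
import Algebra.Properties.CommutativeSemigroup as CommutativeSemigroupProperties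
open import Data.Bool using (true; false; if_then_else_)
open import Data.Bool.Properties using (if-float)
open import Data.Empty using (⊥-elim)
import Data.Integer as ℤ
open import Data.List
  using (List; []; _∷_; _++_; [_]; _∷ʳ_; map; foldr; length; reverse; tabulate; allFin; deduplicate)
import Data.List.Properties as List
open import Data.List.Membership.Propositional using (_∈_)
open import Data.List.Membership.Propositional.Properties using (∈-map⁺; ∈-allFin; ∈-deduplicate⁺)
open import Data.List.Relation.Binary.Permutation.Propositional using (_↭_; ↭-sym; ↭-trans; ↭⇒↭ₛ′)
open import Data.List.Relation.Binary.Permutation.Propositional.Properties using (All-resp-↭; ↭-reverse)
import Data.List.Relation.Binary.Permutation.Propositional.Properties as ↭
open import Data.List.Relation.Binary.Permutation.Setoid.Properties using (foldr-commMonoid)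
open import Data.List.Relation.Unary.All as All using (All; []; _∷_)
import Data.List.Relation.Unary.All.Properties as All
open import Data.List.Relation.Unary.AllPairs using (AllPairs; []; _∷_)
import Data.List.Relation.Unary.AllPairs.Properties as AllPairs
open import Data.List.Relation.Unary.Any using (here; there)
open import Data.List.Relation.Unary.Linked.Properties using (Linked⇒AllPairs)
open import Data.List.Relation.Unary.Unique.Propositional using (Unique)
open import Data.List.Relation.Unary.Unique.DecPropositional.Properties using (deduplicate-!)
open import Data.Nat using (zero; suc)
import Data.Nat as ℕ
import Data.Nat.Properties as ℕ
open import Data.Nat.ListAction using (sum)
open import Data.Nat.ListAction.Properties using (sum-++)
open import Data.Product using (_×_; _,_; proj₁; proj₂)
open import Data.Rational using (0ℚ; 1ℚ; ½)
import Data.Rational as ℚ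
import Data.Rational.Properties as ℚ
open import Data.List.Sort ℚ.≤-decTotalOrder using (sort; sort-↭; sort-↗)
open import Data.Sum using (_⊎_; inj₁; inj₂)
open import Data.Unit using (tt)
open import Data.Vec using ([]; _∷_; lookup; toList; fromList; init; last; initLast)
import Data.Vec.Properties as Vec
open import Function using (id; flip; _∘_)
open import Relation.Binary.Definitions using (DecidableEquality)
open import Relation.Binary.PropositionalEquality
  using (_≡_; refl; sym; trans; cong; cong₂; subst; subst₂; module ≡-Reasoning)
open import Relation.Nullary using (¬_; Dec; yes; no; contradiction)
open import Relation.Nullary.Decidable using (⌊_⌋; toWitness)

module ListSum {c ℓ} (M : CommutativeMonoid c ℓ) where

  open CommutativeMonoid M renaming (refl to ≈-refl; sym to ≈-sym; trans to ≈-trans)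
  open CommutativeSemigroupProperties commutativeSemigroup using (interchange)
  open import Relation.Binary.Reasoning.Setoid setoid

  ∑ : List Carrier → Carrier
  ∑ = foldr _∙_ ε

  ∑-++ : ∀ xs ys → ∑ (xs ++ ys) ≈ ∑ xs ∙ ∑ ys
  ∑-++ []       ys = ≈-sym (identityˡ _)
  ∑-++ (x ∷ xs) ys = ≈-trans (∙-congˡ (∑-++ xs ys)) (≈-sym (assoc x _ _))

  ∑-↭ : ∀ {xs ys} → xs ↭ ys → ∑ xs ≈ ∑ ys
  ∑-↭ xs↭ys = foldr-commMonoid setoid isCommutativeMonoid (↭⇒↭ₛ′ isEquivalence xs↭ys)

  ∑-map-cong : ∀ {B : Set} {g h : B → Carrier} → (∀ b → g b ≈ h b) → ∀ bs → ∑ (map g bs) ≈ ∑ (map h bs)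
  ∑-map-cong g≈h []       = ≈-refl
  ∑-map-cong g≈h (b ∷ bs) = ∙-cong (g≈h b) (∑-map-cong g≈h bs)

  ∑-map-ε : ∀ {B : Set} (bs : List B) → ∑ (map (λ _ → ε) bs) ≈ ε
  ∑-map-ε []       = ≈-refl
  ∑-map-ε (b ∷ bs) = ≈-trans (identityˡ _) (∑-map-ε bs)

  ∑-map-∙ : ∀ {B : Set} (g h : B → Carrier) bs → ∑ (map (λ b → g b ∙ h b) bs) ≈ ∑ (map g bs) ∙ ∑ (map h bs)
  ∑-map-∙ g h []       = ≈-sym (identityˡ ε)
  ∑-map-∙ g h (b ∷ bs) = ≈-trans (∙-congˡ (∑-map-∙ g h bs)) (interchange _ _ _ _)

  ∑-comm : ∀ {B C : Set} (g : B → C → Carrier) bs cs →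
           ∑ (map (λ b → ∑ (map (g b) cs)) bs) ≈ ∑ (map (λ c → ∑ (map (λ b → g b c) bs)) cs)
  ∑-comm g []       cs = ≈-sym (∑-map-ε cs)
  ∑-comm g (b ∷ bs) cs = begin
    ∑ (map (g b) cs) ∙ ∑ (map (λ b → ∑ (map (g b) cs)) bs)         ≈⟨ ∙-congˡ (∑-comm g bs cs) ⟩
    ∑ (map (g b) cs) ∙ ∑ (map (λ c → ∑ (map (λ b → g b c) bs)) cs) ≈⟨ ∑-map-∙ (g b) _ cs ⟨
    ∑ (map (λ c → g b c ∙ ∑ (map (λ b → g b c) bs)) cs)            ∎

  module _ {A : Set} (_≟_ : DecidableEquality A) where

    select : A → Carrier → A → Carrier
    select a x j = if ⌊ a ≟ j ⌋ then x else ε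

    ∑-select-∉ : ∀ a x {js} → All (λ j → ¬ a ≡ j) js → ∑ (map (select a x) js) ≈ ε
    ∑-select-∉ a x {[]}     []           = ≈-refl
    ∑-select-∉ a x {j ∷ js} (a≢j ∷ a∉js) with a ≟ j
    ... | yes a≡j = contradiction a≡j a≢j
    ... | no  _   = ≈-trans (identityˡ _) (∑-select-∉ a x a∉js)

    ∑-select-∈ : ∀ a x {js} → Unique js → a ∈ js → ∑ (map (select a x) js) ≈ x
    ∑-select-∈ a x {j ∷ js} (j∉js ∷ uniq) a∈js with a ≟ j
    ∑-select-∈ a x {j ∷ js} (j∉js ∷ uniq) a∈js         | yes refl =
      ≈-trans (∙-congˡ (∑-select-∉ a x j∉js)) (identityʳ x)
    ∑-select-∈ a x {j ∷ js} (j∉js ∷ uniq) (here a≡j)   | no  a≢j  = contradiction a≡j a≢j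
    ∑-select-∈ a x {j ∷ js} (j∉js ∷ uniq) (there a∈js) | no  _    =
      ≈-trans (identityˡ _) (∑-select-∈ a x uniq a∈js)

    ∑-partition : ∀ {B : Set} (f : B → A) (g : B → Carrier) bs {js} → Unique js → (∀ b → f b ∈ js) →
                  ∑ (map g bs) ≈ ∑ (map (λ j → ∑ (map (λ b → select (f b) (g b) j) bs)) js)
    ∑-partition f g bs {js} uniq f∈js = begin
      ∑ (map g bs)
        ≈⟨ ∑-map-cong (λ b → ≈-sym (∑-select-∈ (f b) (g b) uniq (f∈js b))) bs ⟩
      ∑ (map (λ b → ∑ (map (select (f b) (g b)) js)) bs)
        ≈⟨ ∑-comm (λ b → select (f b) (g b)) bs js ⟩
      ∑ (map (λ j → ∑ (map (λ b → select (f b) (g b) j) bs)) js) ∎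

module ℚΣ = ListSum ℚ.+-0-commutativeMonoid
module ℕΣ = ListSum ℕ.+-0-commutativeMonoid

open import Algebra.Properties.Monoid.Mult ℚ.+-0-monoid using (×-homo-+; ×-assocˡ) renaming (_×_ to _·_)

⅓ ⅔ : ℚ
⅓ = ℤ.+ 1 ℚ./ 3
⅔ = ℤ.+ 2 ℚ./ 3

⅓<½ : ⅓ ℚ.< ½
⅓<½ = toWitness {a? = ⅓ ℚ.<? ½} tt

p≤q+p : ∀ {p q} → 0ℚ ℚ.≤ q → p ℚ.≤ q ℚ.+ p
p≤q+p {p} {q} 0≤q = subst (ℚ._≤ q ℚ.+ p) (ℚ.+-identityˡ p) (ℚ.+-monoˡ-≤ p 0≤q)

p≤p+q : ∀ {p q} → 0ℚ ℚ.≤ q → p ℚ.≤ p ℚ.+ q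
p≤p+q {p} {q} 0≤q = subst (ℚ._≤ p ℚ.+ q) (ℚ.+-identityʳ p) (ℚ.+-monoʳ-≤ p 0≤q)

·-nonneg : ∀ n {x} → 0ℚ ℚ.≤ x → 0ℚ ℚ.≤ n · x
·-nonneg zero    0≤x = ℚ.≤-refl
·-nonneg (suc n) 0≤x = ℚ.+-mono-≤ 0≤x (·-nonneg n 0≤x)

·-monoˡ-≤ : ∀ {x m n} → 0ℚ ℚ.≤ x → m ≤ n → m · x ℚ.≤ n · x
·-monoˡ-≤ {n = n} 0≤x ℕ.z≤n       = ·-nonneg n 0≤x
·-monoˡ-≤ {x}     0≤x (ℕ.s≤s m≤n) = ℚ.+-monoʳ-≤ x (·-monoˡ-≤ 0≤x m≤n)

·-cancelʳ-< : ∀ {x} m n → 0ℚ ℚ.≤ x → m · x ℚ.< n · x → m ℕ.< n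
·-cancelʳ-< m n 0≤x m·x<n·x with m ℕ.<? n
... | yes m<n = m<n
... | no  m≮n = ⊥-elim (ℚ.<-irrefl refl (ℚ.<-≤-trans m·x<n·x (·-monoˡ-≤ 0≤x (ℕ.≮⇒≥ m≮n))))

thirds : ∀ m n → m · (n · ⅓) ≡ (n * m) · ⅓
thirds m n = trans (×-assocˡ ⅓ m n) (cong (_· ⅓) (ℕ.*-comm m n))

totalSize : List ℚ → ℚ
totalSize = ℚΣ.∑

totalSize-nonneg : ∀ {ys} → All (0ℚ ℚ.≤_) ys → 0ℚ ℚ.≤ totalSize ys
totalSize-nonneg []           = ℚ.≤-refl
totalSize-nonneg (0≤y ∷ 0≤ys) = ℚ.+-mono-≤ 0≤y (totalSize-nonneg 0≤ys)

totalSize-map-≤ : ∀ {B : Set} (g : B → ℚ) {x} bs → (∀ b → g b ℚ.≤ x) → totalSize (map g bs) ℚ.≤ length bs · x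
totalSize-map-≤ g []       g≤x = ℚ.≤-refl
totalSize-map-≤ g (b ∷ bs) g≤x = ℚ.+-mono-≤ (g≤x b) (totalSize-map-≤ g bs g≤x)

sum-map-≤ : ∀ {B : Set} (g : B → ℕ) {K} bs → (∀ b → g b ≤ K) → sum (map g bs) ≤ length bs * K
sum-map-≤ g []       g≤K = ℕ.z≤n
sum-map-≤ g (b ∷ bs) g≤K = ℕ.+-mono-≤ (g≤K b) (sum-map-≤ g bs g≤K)

above : ℚ → ℚ → ℕ
above t y = if ⌊ t ℚ.<? y ⌋ then 1 else 0

above-< : ∀ {t y} → t ℚ.< y → above t y ≡ 1
above-< {t} {y} t<y with t ℚ.<? y
... | yes _   = refl
... | no  t≮y = contradiction t<y t≮y

above-≤ : ∀ {t y} → y ℚ.≤ t → above t y ≡ 0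
above-≤ {t} {y} y≤t with t ℚ.<? y
... | yes t<y = ⊥-elim (ℚ.<-irrefl refl (ℚ.<-≤-trans t<y y≤t))
... | no  _   = refl

countAbove : ℚ → List ℚ → ℕ
countAbove t ys = sum (map (above t) ys)

·-<-totalSize : ∀ t m {ys} → All (0ℚ ℚ.≤_) ys → suc m ≤ countAbove t ys → suc m · t ℚ.< totalSize ys
·-<-totalSize t m {y ∷ ys} (0≤y ∷ 0≤ys) m<count with t ℚ.<? y
·-<-totalSize t m       (0≤y ∷ 0≤ys) m<count | no  _   =
  ℚ.<-≤-trans (·-<-totalSize t m 0≤ys m<count) (p≤q+p 0≤y)
·-<-totalSize t zero    (0≤y ∷ 0≤ys) m<count | yes t<y = ℚ.+-mono-<-≤ t<y (totalSize-nonneg 0≤ys)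
·-<-totalSize t (suc m) (0≤y ∷ 0≤ys) m<count | yes t<y =
  ℚ.+-mono-< t<y (·-<-totalSize t m 0≤ys (ℕ.s≤s⁻¹ m<count))

countAbove-≤ : ∀ K {t ys} → suc K · t ≡ 1ℚ → All (0ℚ ℚ.≤_) ys → totalSize ys ℚ.≤ 1ℚ → countAbove t ys ≤ K
countAbove-≤ K {t} {ys} K+1·t≡1 0≤ys size≤1 with countAbove t ys ℕ.≤? K
... | yes count≤K = count≤K
... | no  count≰K = ⊥-elim (ℚ.<-irrefl K+1·t≡1
        (ℚ.<-≤-trans (·-<-totalSize t K 0≤ys (ℕ.≰⇒> count≰K)) size≤1))

weight : ℚ → ℕ
weight y = above ½ y + above ⅓ y

weight-large : ∀ {y} → ½ ℚ.< y → weight y ≡ 2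
weight-large ½<y = cong₂ _+_ (above-< ½<y) (above-< (ℚ.<-trans ⅓<½ ½<y))

weight-medium : ∀ {y} → ⅓ ℚ.< y → 1 ≤ weight y
weight-medium {y} ⅓<y = subst (1 ≤_) (cong (above ½ y +_) (sym (above-< ⅓<y))) (ℕ.m≤n+m 1 (above ½ y))

totalWeight : List ℚ → ℕ
totalWeight ys = sum (map weight ys)

totalSize-↭ : ∀ {xs ys} → xs ↭ ys → totalSize xs ≡ totalSize ys
totalSize-↭ = ℚΣ.∑-↭

totalWeight-↭ : ∀ {xs ys} → xs ↭ ys → totalWeight xs ≡ totalWeight ys
totalWeight-↭ xs↭ys = ℕΣ.∑-↭ (↭.map⁺ weight xs↭ys)

tabulate-lookup : ∀ {A : Set} {n} (v : Vec A n) → tabulate (lookup v) ≡ toList v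
tabulate-lookup []      = refl
tabulate-lookup (x ∷ v) = cong (x ∷_) (tabulate-lookup v)

map-lookup-allFin : ∀ {A : Set} {n} (v : Vec A n) → map (lookup v) (allFin n) ≡ toList v
map-lookup-allFin v = trans (List.map-tabulate id (lookup v)) (tabulate-lookup v)

module _ {n} (I : Vec ℚ n) (f : Assignment n) where

  private
    labels : List ℕ
    labels = deduplicate ℕ._≟_ (map f (allFin n))

    labels-unique : Unique labels
    labels-unique = deduplicate-! ℕ._≟_ (map f (allFin n))

    ∈-labels : ∀ i → f i ∈ labels
    ∈-labels i = ∈-deduplicate⁺ ℕ._≟_ (∈-map⁺ f (∈-allFin i))

    -- The contents of bin j, padded with zeros so that load I f j is its total size.
    binItems : ℕ → List ℚ
    binItems j = map (λ i → if ⌊ f i ℕ.≟ j ⌋ then lookup I i else 0ℚ) (allFin n)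

  totalSize≤cost : Feasible I f → totalSize (toList I) ℚ.≤ cost f · 1ℚ
  totalSize≤cost feasible = begin
    totalSize (toList I)                  ≡⟨ cong totalSize (map-lookup-allFin I) ⟨
    totalSize (map (lookup I) (allFin n)) ≡⟨ ℚΣ.∑-partition ℕ._≟_ f (lookup I) (allFin n) labels-unique ∈-labels ⟩
    totalSize (map (load I f) labels)     ≤⟨ totalSize-map-≤ (load I f) labels feasible ⟩
    cost f · 1ℚ                           ∎
    where open ℚ.≤-Reasoning

  countAbove≤cost : ValidItems I → Feasible I f →
                    ∀ K {t} → 0ℚ ℚ.≤ t → suc K · t ≡ 1ℚ → countAbove t (toList I) ≤ cost f * K
  countAbove≤cost valid feasible K {t} 0≤t K+1·t≡1 = begin
    countAbove t (toList I)
      ≡⟨ cong (countAbove t) (map-lookup-allFin I) ⟨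
    sum (map (above t) (map (lookup I) (allFin n)))
      ≡⟨ cong sum (List.map-∘ (allFin n)) ⟨
    sum (map (above t ∘ lookup I) (allFin n))
      ≡⟨ ℕΣ.∑-partition ℕ._≟_ f (above t ∘ lookup I) (allFin n) labels-unique ∈-labels ⟩
    sum (map (λ j → sum (map (λ i → if ⌊ f i ℕ.≟ j ⌋ then above t (lookup I i) else 0) (allFin n))) labels)
      ≡⟨ cong sum (List.map-cong count-bin labels) ⟩
    sum (map (λ j → countAbove t (binItems j)) labels)
      ≤⟨ sum-map-≤ _ labels (λ j → countAbove-≤ K K+1·t≡1 (binItems-nonneg j) (feasible j)) ⟩
    cost f * K
      ∎
    where
    open ℕ.≤-Reasoning

    binItems-nonneg : ∀ j → All (0ℚ ℚ.≤_) (binItems j)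
    binItems-nonneg j = All.map⁺ (All.tabulate⁺ item-nonneg)
      where
      item-nonneg : ∀ i → 0ℚ ℚ.≤ (if ⌊ f i ℕ.≟ j ⌋ then lookup I i else 0ℚ)
      item-nonneg i with f i ℕ.≟ j
      ... | yes _ = ℚ.<⇒≤ (proj₁ (valid i))
      ... | no  _ = ℚ.≤-refl

    count-bin : ∀ j → sum (map (λ i → if ⌊ f i ℕ.≟ j ⌋ then above t (lookup I i) else 0) (allFin n))
                    ≡ countAbove t (binItems j)
    count-bin j = trans (cong sum (List.map-cong float (allFin n))) (cong sum (List.map-∘ (allFin n)))
      where
      float : ∀ i → (if ⌊ f i ℕ.≟ j ⌋ then above t (lookup I i) else 0)
                  ≡ above t (if ⌊ f i ℕ.≟ j ⌋ then lookup I i else 0ℚ)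
      float i = trans (cong (if ⌊ f i ℕ.≟ j ⌋ then above t (lookup I i) else_) (sym (above-≤ 0≤t)))
                      (sym (if-float (above t) ⌊ f i ℕ.≟ j ⌋))

  totalWeight≤cost : ValidItems I → Feasible I f → totalWeight (toList I) ≤ 3 * cost f
  totalWeight≤cost valid feasible = begin
    totalWeight (toList I)
      ≡⟨ ℕΣ.∑-map-∙ (above ½) (above ⅓) (toList I) ⟩
    countAbove ½ (toList I) + countAbove ⅓ (toList I)
      ≤⟨ ℕ.+-mono-≤ (countAbove≤cost valid feasible 1 (ℚ.nonNegative⁻¹ ½) refl)
                    (countAbove≤cost valid feasible 2 (ℚ.nonNegative⁻¹ ⅓) refl) ⟩
    cost f * 1 + cost f * 2
      ≡⟨ ℕ.*-distribˡ-+ (cost f) 1 2 ⟨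
    cost f * 3
      ≡⟨ ℕ.*-comm (cost f) 3 ⟩
    3 * cost f
      ∎
    where open ℕ.≤-Reasoning

Descending : List ℚ → Set
Descending = AllPairs ℚ._≥_

AllPairs-reverse⁺ : ∀ {A : Set} {R : A → A → Set} {xs} → AllPairs R xs → AllPairs (flip R) (reverse xs)
AllPairs-reverse⁺ {xs = []}     []         = []
AllPairs-reverse⁺ {xs = x ∷ xs} (Rx ∷ Rxs) = subst (AllPairs _) (sym (List.unfold-reverse x xs))
  (AllPairs.++⁺ (AllPairs-reverse⁺ Rxs) ([] ∷ [])
    (All.map (_∷ []) (All-resp-↭ (↭-sym (↭-reverse xs)) Rx)))

AllPairs-++⁻ˡ : ∀ {A : Set} {R : A → A → Set} xs {ys} → AllPairs R (xs ++ ys) → AllPairs R xs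
AllPairs-++⁻ˡ []       _          = []
AllPairs-++⁻ˡ (x ∷ xs) (Rx ∷ Rxs) = All.++⁻ˡ xs Rx ∷ AllPairs-++⁻ˡ xs Rxs

AllPairs-∷ʳ⇒last : ∀ {A : Set} {R : A → A → Set} → (∀ {a} → R a a) →
                   ∀ xs {z} → AllPairs R (xs ∷ʳ z) → All (λ y → R y z) (xs ∷ʳ z)
AllPairs-∷ʳ⇒last R-refl []       _          = R-refl ∷ []
AllPairs-∷ʳ⇒last R-refl (x ∷ xs) (Rx ∷ Rxs) = All.head (All.++⁻ʳ xs Rx) ∷ AllPairs-∷ʳ⇒last R-refl xs Rxs

sortDesc-descending : ∀ xs → Descending (sortDesc xs)
sortDesc-descending xs = AllPairs-reverse⁺ (Linked⇒AllPairs ℚ.≤-trans (sort-↗ xs))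

sortDesc-↭ : ∀ xs → sortDesc xs ↭ xs
sortDesc-↭ xs = ↭-trans (↭-reverse (sort xs)) (sort-↭ xs)

toList-init-last : ∀ {A : Set} {k} (v : Vec A (suc k)) → toList v ≡ toList (init v) ∷ʳ last v
toList-init-last v = trans (cong toList (proj₂ (proj₂ (initLast v)))) (Vec.toList-∷ʳ (last v) (init v))

module TailItem {k} (x : ℚ) (xs : Vec ℚ k) where

  item : ℚ
  item = last (x ∷ xs)

  others : List ℚ
  others = toList (init (x ∷ xs))

  private
    split : x ∷ toList xs ≡ others ∷ʳ item
    split = toList-init-last (x ∷ xs)

  others-all : ∀ {P : ℚ → Set} → All P (x ∷ toList xs) → All P others
  others-all ps = All.++⁻ˡ others (subst (All _) split ps)

  item-all : ∀ {P : ℚ → Set} → All P (x ∷ toList xs) → P item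
  item-all ps = All.head (All.++⁻ʳ others (subst (All _) split ps))

  others-descending : Descending (x ∷ toList xs) → Descending others
  others-descending desc = AllPairs-++⁻ˡ others (subst Descending split desc)

  item-≤ : Descending (x ∷ toList xs) → All (item ℚ.≤_) (x ∷ toList xs)
  item-≤ desc = subst (All _) (sym split) (AllPairs-∷ʳ⇒last ℚ.≤-refl others (subst Descending split desc))

  size-split : totalSize (x ∷ toList xs) ≡ item ℚ.+ totalSize others
  size-split = begin
    totalSize (x ∷ toList xs)               ≡⟨ cong totalSize split ⟩
    totalSize (others ∷ʳ item)              ≡⟨ ℚΣ.∑-++ others [ item ] ⟩
    totalSize others ℚ.+ totalSize [ item ] ≡⟨ ℚ.+-comm (totalSize others) _ ⟩
    totalSize [ item ] ℚ.+ totalSize others ≡⟨ cong (ℚ._+ totalSize others) (ℚ.+-identityʳ item) ⟩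
    item ℚ.+ totalSize others               ∎
    where open ≡-Reasoning

  weight-split : totalWeight (x ∷ toList xs) ≡ weight item + totalWeight others
  weight-split = begin
    totalWeight (x ∷ toList xs)                ≡⟨ cong totalWeight split ⟩
    sum (map weight (others ∷ʳ item))          ≡⟨ cong sum (List.map-++ weight others [ item ]) ⟩
    sum (map weight others ∷ʳ weight item)     ≡⟨ sum-++ (map weight others) [ weight item ] ⟩
    totalWeight others + totalWeight [ item ]  ≡⟨ ℕ.+-comm (totalWeight others) _ ⟩
    totalWeight [ item ] + totalWeight others  ≡⟨ cong (_+ totalWeight others) (ℕ.+-identityʳ (weight item)) ⟩
    weight item + totalWeight others           ∎
    where open ≡-Reasoning

overflow⇒⅓< : ∀ {ld z} → ld ℚ.≤ ⅔ → 1ℚ ℚ.< ld ℚ.+ z → ⅓ ℚ.< z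
overflow⇒⅓< {ld} {z} ld≤⅔ overflow with z ℚ.≤? ⅓
... | yes z≤⅓ = ⊥-elim (ℚ.<-irrefl refl (ℚ.<-≤-trans overflow (ℚ.+-mono-≤ ld≤⅔ z≤⅓)))
... | no  z≰⅓ = ℚ.≰⇒> z≰⅓

overflow⇒⅔< : ∀ {ld z} → z ℚ.+ z ℚ.≤ ld → 1ℚ ℚ.< ld ℚ.+ z → ⅔ ℚ.< ld
overflow⇒⅔< {ld} {z} 2z≤ld overflow with ld ℚ.≤? ⅔
... | yes ld≤⅔ = ⊥-elim (ℚ.<-irrefl refl (ℚ.<-≤-trans ⅔<2z (ℚ.≤-trans 2z≤ld ld≤⅔)))
  where
  ⅔<2z : ⅔ ℚ.< z ℚ.+ z
  ⅔<2z = ℚ.+-mono-< (overflow⇒⅓< ld≤⅔ overflow) (overflow⇒⅓< ld≤⅔ overflow)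
... | no  ld≰⅔ = ℚ.≰⇒> ld≰⅔

-- Satisfied by r bins of total load s all of which, except possibly the last, have load above ⅔.
record SizeBound (r : ℕ) (s : ℚ) : Set where
  constructor size-bound
  field
    ⅔-bound : r · ⅔ ℚ.< s ℚ.+ ⅔

-- by-weight is satisfied by r bins of total weight w when the last has weight at least 1 and the
-- others at least 2.
data BinBound (r : ℕ) (s : ℚ) (w : ℕ) : Set where
  by-size   : SizeBound r s → BinBound r s w
  by-weight : 2 * r ≤ w + 1 → BinBound r s w

BinBound-mono : ∀ {r s s′ w w′} → s ℚ.≤ s′ → w ≤ w′ → BinBound r s w → BinBound r s′ w′
BinBound-mono s≤s′ w≤w′ (by-size (size-bound b)) = by-size (size-bound (ℚ.<-≤-trans b (ℚ.+-monoˡ-≤ ⅔ s≤s′)))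
BinBound-mono s≤s′ w≤w′ (by-weight b)            = by-weight (ℕ.≤-trans b (ℕ.+-monoˡ-≤ 1 w≤w′))

SizeBound-suc : ∀ {ld r s} → ⅔ ℚ.< ld → SizeBound r s → SizeBound (suc r) (ld ℚ.+ s)
SizeBound-suc {ld} {r} {s} ⅔<ld (size-bound b) = size-bound (begin-strict
  ⅔ ℚ.+ r · ⅔      <⟨ ℚ.+-mono-< ⅔<ld b ⟩
  ld ℚ.+ (s ℚ.+ ⅔) ≡⟨ ℚ.+-assoc ld s ⅔ ⟨
  ld ℚ.+ s ℚ.+ ⅔   ∎)
  where open ℚ.≤-Reasoning

double-suc-≤ : ∀ {u v r} → 2 ≤ u → 2 * r ≤ v + 1 → 2 * suc r ≤ u + v + 1
double-suc-≤ {u} {v} {r} 2≤u 2r≤v+1 = begin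
  2 * suc r   ≡⟨ ℕ.*-suc 2 r ⟩
  2 + 2 * r   ≤⟨ ℕ.+-mono-≤ 2≤u 2r≤v+1 ⟩
  u + (v + 1) ≡⟨ ℕ.+-assoc u v 1 ⟨
  u + v + 1   ∎
  where open ℕ.≤-Reasoning

BinBound-suc : ∀ {ld r s w} → ⅔ ℚ.< ld → BinBound r s w → BinBound (suc r) (ld ℚ.+ s) (2 + w)
BinBound-suc ⅔<ld (by-size   b) = by-size (SizeBound-suc ⅔<ld b)
BinBound-suc ⅔<ld (by-weight b) = by-weight (double-suc-≤ ℕ.≤-refl b)

SizeBound⇒ : ∀ {r c} → SizeBound r (c · 1ℚ) → 2 * r ℕ.< 3 * c + 2
SizeBound⇒ {r} {c} (size-bound b) = ·-cancelʳ-< (2 * r) (3 * c + 2) (ℚ.nonNegative⁻¹ ⅓) (begin-strict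
  (2 * r) · ⅓           ≡⟨ thirds r 2 ⟨
  r · ⅔                 <⟨ b ⟩
  c · 1ℚ ℚ.+ ⅔          ≡⟨ cong (ℚ._+ ⅔) (thirds c 3) ⟩
  (3 * c) · ⅓ ℚ.+ 2 · ⅓ ≡⟨ ×-homo-+ ⅓ (3 * c) 2 ⟨
  (3 * c + 2) · ⅓       ∎)
  where open ℚ.≤-Reasoning

BinBound⇒ : ∀ {r c} → BinBound r (c · 1ℚ) (3 * c) → 2 * r ≤ 3 * c + 2
BinBound⇒ {c = c} (by-size   b) = ℕ.<⇒≤ (SizeBound⇒ {c = c} b)
BinBound⇒ {c = c} (by-weight b) = ℕ.≤-trans b (ℕ.+-monoʳ-≤ (3 * c) (ℕ.n≤1+n 1))

binsFrom : ∀ {k} → ℚ → Vec ℚ k → ℕ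
binsFrom ld xs = mmLoop _ ld true xs

Valid Small : ℚ → Set
Valid y = 0ℚ ℚ.< y × y ℚ.≤ 1ℚ
Small y = 0ℚ ℚ.< y × y ℚ.≤ ½

-- The state right after a bin is opened by an item ld ≤ ½: the next item fits beside it.
FreshBin : ℚ → List ℚ → Set
FreshBin ld ys = ld ℚ.≤ ½ × All (ℚ._≤ ld) ys

heavy⊎fresh : ∀ {x ys} → All (ℚ._≤ x) ys → 2 ≤ weight x ⊎ FreshBin x ys
heavy⊎fresh {x} ys≤x with x ℚ.≤? ½
... | yes x≤½ = inj₂ (x≤½ , ys≤x)
... | no  x≰½ = inj₁ (ℕ.≤-reflexive (sym (weight-large (ℚ.≰⇒> x≰½))))

-- w is the weight of the current bin.
binsFrom-above-⅓ : ∀ {k} ld (xs : Vec ℚ k) w → Descending (toList xs) → All (⅓ ℚ.<_) (toList xs) →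
                   1 ≤ w → 2 ≤ w ⊎ FreshBin ld (toList xs) →
                   2 * binsFrom ld xs ≤ w + totalWeight (toList xs) + 1
binsFrom-above-⅓ ld []       w _ _ 1≤w _ = ℕ.+-monoˡ-≤ 1 (ℕ.≤-trans 1≤w (ℕ.m≤m+n w 0))
binsFrom-above-⅓ ld (x ∷ xs) w (x≥xs ∷ desc) (⅓<x ∷ ⅓<xs) 1≤w heavy with (ld ℚ.+ x) ℚ.≤? 1ℚ
... | yes _ = ℕ.≤-trans
  (binsFrom-above-⅓ (ld ℚ.+ x) xs (w + weight x) desc ⅓<xs
     (ℕ.≤-trans 1≤w (ℕ.m≤m+n w _)) (inj₁ (ℕ.+-mono-≤ 1≤w (weight-medium ⅓<x))))
  (ℕ.≤-reflexive (cong (_+ 1) (ℕ.+-assoc w (weight x) _)))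
... | no x-misfits with heavy
...   | inj₂ (ld≤½ , x≤ld ∷ _) = contradiction (ℚ.+-mono-≤ ld≤½ (ℚ.≤-trans x≤ld ld≤½)) x-misfits
...   | inj₁ 2≤w with (ld ℚ.+ last (x ∷ xs)) ℚ.≤? 1ℚ
...     | yes _ = ℕ.≤-trans
  (binsFrom-above-⅓ (ld ℚ.+ item) (init (x ∷ xs)) (w + weight item)
     (others-descending (x≥xs ∷ desc)) (others-all (⅓<x ∷ ⅓<xs))
     (ℕ.≤-trans 1≤w (ℕ.m≤m+n w _)) (inj₁ (ℕ.≤-trans 2≤w (ℕ.m≤m+n w _))))
  (ℕ.≤-reflexive (cong (_+ 1) (trans (ℕ.+-assoc w (weight item) _) (cong (w +_) (sym weight-split)))))
  where open TailItem x xs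
...     | no  _ = double-suc-≤ 2≤w
  (binsFrom-above-⅓ x xs (weight x) desc ⅓<xs (weight-medium ⅓<x) (heavy⊎fresh x≥xs))

binsFrom-below-½ : ∀ {k} ld (xs : Vec ℚ k) → Descending (toList xs) → All Small (toList xs) → 0ℚ ℚ.< ld →
                   FreshBin ld (toList xs) ⊎ All (λ y → y ℚ.+ y ℚ.≤ ld) (toList xs) →
                   SizeBound (binsFrom ld xs) (ld ℚ.+ totalSize (toList xs))
binsFrom-below-½ ld [] _ _ 0<ld _ =
  size-bound (ℚ.+-monoˡ-< ⅔ (subst (0ℚ ℚ.<_) (sym (ℚ.+-identityʳ ld)) 0<ld))
binsFrom-below-½ ld (x ∷ xs) (x≥xs ∷ desc) ((0<x , x≤½) ∷ small) 0<ld fresh⊎halves with (ld ℚ.+ x) ℚ.≤? 1ℚ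
... | yes _ = subst (SizeBound _) (ℚ.+-assoc ld x _)
  (binsFrom-below-½ (ld ℚ.+ x) xs desc small (ℚ.+-mono-< 0<ld 0<x) (inj₂ (halves fresh⊎halves)))
  where
  halves : FreshBin ld (x ∷ toList xs) ⊎ All (λ y → y ℚ.+ y ℚ.≤ ld) (x ∷ toList xs) →
           All (λ y → y ℚ.+ y ℚ.≤ ld ℚ.+ x) (toList xs)
  halves (inj₁ (_ , _ ∷ xs≤ld)) = All.zipWith (λ (y≤ld , y≤x) → ℚ.+-mono-≤ y≤ld y≤x) (xs≤ld , x≥xs)
  halves (inj₂ (_ ∷ 2xs≤ld))    = All.map (λ 2y≤ld → ℚ.≤-trans 2y≤ld (p≤p+q (ℚ.<⇒≤ 0<x))) 2xs≤ld
... | no x-misfits with fresh⊎halves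
...   | inj₁ (ld≤½ , _) = contradiction (ℚ.+-mono-≤ ld≤½ x≤½) x-misfits
...   | inj₂ 2xs≤ld with (ld ℚ.+ last (x ∷ xs)) ℚ.≤? 1ℚ
...     | yes _ = subst (SizeBound _) size-eq
  (binsFrom-below-½ (ld ℚ.+ item) (init (x ∷ xs)) (others-descending (x≥xs ∷ desc))
     (others-all ((0<x , x≤½) ∷ small)) (ℚ.+-mono-< 0<ld 0<item)
     (inj₂ (All.map (λ 2y≤ld → ℚ.≤-trans 2y≤ld (p≤p+q (ℚ.<⇒≤ 0<item))) (others-all 2xs≤ld))))
  where
  open TailItem x xs
  0<item : 0ℚ ℚ.< item
  0<item = proj₁ (item-all ((0<x , x≤½) ∷ small))
  size-eq : ld ℚ.+ item ℚ.+ totalSize others ≡ ld ℚ.+ totalSize (x ∷ toList xs)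
  size-eq = trans (ℚ.+-assoc ld item _) (cong (ld ℚ.+_) (sym size-split))
...     | no  item-misfits = SizeBound-suc (overflow⇒⅔< (TailItem.item-all x xs 2xs≤ld) (ℚ.≰⇒> item-misfits))
  (binsFrom-below-½ x xs desc small 0<x (inj₁ (x≤½ , x≥xs)))

mutual

  -- The summand 2 is the weight of the item larger than ½ that the current bin holds
  -- wherever this is used; the bound itself holds for every load.
  binsFrom-heavy : ∀ {k} ld (xs : Vec ℚ k) → Descending (toList xs) → All Valid (toList xs) →
                   BinBound (binsFrom ld xs) (ld ℚ.+ totalSize (toList xs)) (2 + totalWeight (toList xs))
  binsFrom-heavy ld [] _ _ = by-weight (ℕ.n≤1+n 2)
  binsFrom-heavy ld (x ∷ xs) (x≥xs ∷ desc) (valid-x ∷ valid) with (ld ℚ.+ x) ℚ.≤? 1ℚ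
  ... | yes _ = BinBound-mono (ℚ.≤-reflexive (ℚ.+-assoc ld x _)) (ℕ.+-monoʳ-≤ 2 (ℕ.m≤n+m _ (weight x)))
    (binsFrom-heavy (ld ℚ.+ x) xs desc valid)
  ... | no _ with (ld ℚ.+ last (x ∷ xs)) ℚ.≤? 1ℚ
  ...   | yes _ = BinBound-mono (ℚ.≤-reflexive size-eq) (ℕ.+-monoʳ-≤ 2 weight-≤)
    (binsFrom-heavy (ld ℚ.+ item) (init (x ∷ xs))
       (others-descending (x≥xs ∷ desc)) (others-all (valid-x ∷ valid)))
    where
    open TailItem x xs
    size-eq : ld ℚ.+ item ℚ.+ totalSize others ≡ ld ℚ.+ totalSize (x ∷ toList xs)
    size-eq = trans (ℚ.+-assoc ld item _) (cong (ld ℚ.+_) (sym size-split))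
    weight-≤ : totalWeight others ≤ totalWeight (x ∷ toList xs)
    weight-≤ = ℕ.≤-trans (ℕ.m≤n+m _ (weight item)) (ℕ.≤-reflexive (sym weight-split))
  ...   | no item-misfits = close (ld ℚ.≤? ⅔)
    where
    open TailItem x xs
    close : Dec (ld ℚ.≤ ⅔) → BinBound (suc (binsFrom x xs))
                                      (ld ℚ.+ totalSize (x ∷ toList xs)) (2 + totalWeight (x ∷ toList xs))
    close (yes ld≤⅔) = by-weight (double-suc-≤ ℕ.≤-refl
      (binsFrom-above-⅓ x xs (weight x) desc (All.tail ⅓<all)
         (weight-medium (All.head ⅓<all)) (heavy⊎fresh x≥xs)))
      where
      ⅓<all : All (⅓ ℚ.<_) (x ∷ toList xs)
      ⅓<all = All.map (ℚ.<-≤-trans (overflow⇒⅓< ld≤⅔ (ℚ.≰⇒> item-misfits))) (item-≤ (x≥xs ∷ desc))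
    close (no ld≰⅔) = BinBound-suc (ℚ.≰⇒> ld≰⅔) (binsFrom-opened x xs (x≥xs ∷ desc) (valid-x ∷ valid))

  binsFrom-opened : ∀ {k} x (xs : Vec ℚ k) → Descending (x ∷ toList xs) → All Valid (x ∷ toList xs) →
                    BinBound (binsFrom x xs) (totalSize (x ∷ toList xs)) (totalWeight (x ∷ toList xs))
  binsFrom-opened x xs (x≥xs ∷ desc) ((0<x , _) ∷ valid) with x ℚ.≤? ½
  ... | yes x≤½ = by-size (binsFrom-below-½ x xs desc small 0<x (inj₁ (x≤½ , x≥xs)))
    where
    small : All Small (toList xs)
    small = All.zipWith (λ ((0<y , _) , y≤x) → 0<y , ℚ.≤-trans y≤x x≤½) (valid , x≥xs)
  ... | no  x≰½ = subst (BinBound _ _) (cong (_+ totalWeight (toList xs)) (sym (weight-large (ℚ.≰⇒> x≰½))))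
    (binsFrom-heavy x xs desc valid)

mmLoop-opens : ∀ {k} x (xs : Vec ℚ k) → x ℚ.≤ 1ℚ → mmLoop (suc k) 0ℚ false (x ∷ xs) ≡ binsFrom x xs
mmLoop-opens x xs x≤1 with (0ℚ ℚ.+ x) ℚ.≤? 1ℚ
... | yes _   = cong (λ ld → binsFrom ld xs) (ℚ.+-identityˡ x)
... | no  x≰1 = contradiction (subst (ℚ._≤ 1ℚ) (sym (ℚ.+-identityˡ x)) x≤1) x≰1

mmLoop-bound : ∀ {k} (xs : Vec ℚ k) → Descending (toList xs) → All Valid (toList xs) →
               BinBound (mmLoop k 0ℚ false xs) (totalSize (toList xs)) (totalWeight (toList xs))
mmLoop-bound []       _    _                     = by-weight ℕ.z≤n
mmLoop-bound (x ∷ xs) desc valid@((_ , x≤1) ∷ _) =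
  subst (λ r → BinBound r (totalSize (x ∷ toList xs)) (totalWeight (x ∷ toList xs)))
        (sym (mmLoop-opens x xs x≤1)) (binsFrom-opened x xs desc valid)

MM-bound : ∀ {n} (I : Vec ℚ n) → ValidItems I →
           BinBound (MM I) (totalSize (toList I)) (totalWeight (toList I))
MM-bound I valid = subst₂ (BinBound (MM I)) size-eq weight-eq (mmLoop-bound (fromList sorted) desc valid′)
  where
  sorted : List ℚ
  sorted = sortDesc (toList I)

  toList-sorted : toList (fromList sorted) ≡ sorted
  toList-sorted = Vec.toList∘fromList sorted

  desc : Descending (toList (fromList sorted))
  desc = subst Descending (sym toList-sorted) (sortDesc-descending (toList I))

  valid′ : All Valid (toList (fromList sorted))
  valid′ = subst (All Valid) (sym toList-sorted) (All-resp-↭ (↭-sym (sortDesc-↭ (toList I)))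
    (subst (All Valid) (tabulate-lookup I) (All.tabulate⁺ valid)))

  size-eq : totalSize (toList (fromList sorted)) ≡ totalSize (toList I)
  size-eq = trans (cong totalSize toList-sorted) (totalSize-↭ (sortDesc-↭ (toList I)))

  weight-eq : totalWeight (toList (fromList sorted)) ≡ totalWeight (toList I)
  weight-eq = trans (cong totalWeight toList-sorted) (totalWeight-↭ (sortDesc-↭ (toList I)))

theorem1 : (n : ℕ) (I : Vec ℚ n) → ValidItems I →
           (f : Assignment n) → Feasible I f →
           2 * MM I ≤ 3 * cost f + 2
theorem1 n I valid f feasible = BinBound⇒ {c = cost f}
  (BinBound-mono (totalSize≤cost I f feasible) (totalWeight≤cost I f valid feasible) (MM-bound I valid))
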